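{- Let $\ell,k$ be positive integers with $k\ge2$, and consider the graph $G_{\ell,k}$. Then the equivalence classes of $\sim_u$ are the sets $\{x_{j,a}:1\le a\le k\}$ for $j=1,\dots,\ell-1$, together with $\{v\}$.
   Context: $G_{\ell,k}$ is built as follows: for each $1\le a\le k$ take a path $x_{0,a}x_{1,a}\cdots x_{\ell,a}$ (these paths disjoint); identify all $x_{0,a}$ into a single vertex $u$ and all $x_{\ell,a}$ into a single vertex $v$; then add the edge $uv$. For vertices $y,z\ne u$, $y\sim_u z$ means there is a graph automorphism $\pi$ of $G_{\ell,k}$ with $\pi(u)=u$ and $\pi(y)=z$; this is an equivalence relation on $V\setminus\{u\}$. -}

module Defs where

open import Data.Nat using (ℕ; zero; suc; _≤_; _<?_)
open import Data.Fin using (Fin; fromℕ<)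
open import Data.Product using (Σ; _×_; ∃; ∃-syntax)
open import Function.Definitions using (Bijective)
open import Function.Bundles using (_⇔_)
open import Relation.Nullary using (yes; no)
open import Relation.Binary.PropositionalEquality using (_≡_)

-- Vertices of G_{ℓ,k} with ℓ = suc m.
-- U = u, V = v, and  X j a  is the vertex  x_{toℕ j + 1, a}
-- (internal path vertices, 1 ≤ toℕ j + 1 ≤ ℓ - 1 = m, a ∈ Fin k).
data Vtx (m k : ℕ) : Set where
  U : Vtx m k
  V : Vtx m k
  X : Fin m → Fin k → Vtx m k

-- vert m j a  is the vertex x_{j,a} on path a (position j, 0 ≤ j ≤ ℓ = suc m),
-- after identifying all x_{0,a} with u and all x_{ℓ,a} with v.
vert : (m : ℕ) {k : ℕ} → ℕ → Fin k → Vtx m k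
vert m zero a = U
vert m (suc j) a with j <? m
... | yes p = X (fromℕ< p) a
... | no _ = V

data Adj (m k : ℕ) : Vtx m k → Vtx m k → Set where
  edge-uv : Adj m k U V
  edge-vu : Adj m k V U
  path-fw : (a : Fin k) (j : ℕ) → j ≤ m → Adj m k (vert m j a) (vert m (suc j) a)
  path-bw : (a : Fin k) (j : ℕ) → j ≤ m → Adj m k (vert m (suc j) a) (vert m j a)

IsAutomorphism : (m k : ℕ) → (Vtx m k → Vtx m k) → Set
IsAutomorphism m k π =
  Bijective _≡_ _≡_ π × (∀ y z → Adj m k y z ⇔ Adj m k (π y) (π z))

_∼u_ : {m k : ℕ} → Vtx m k → Vtx m k → Set
_∼u_ {m} {k} y z =
  ∃[ π ] (IsAutomorphism m k π × π U ≡ U × π y ≡ z)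

data SameBlock {m k : ℕ} : Vtx m k → Vtx m k → Set where
  both-v : SameBlock V V
  same-level : (j : Fin m) (a b : Fin k) → SameBlock (X j a) (X j b)

{-# OPTIONS --safe #-}
-- Permuting the k paths gives automorphisms fixing u that move x_{j,a} to x_{j,b}.
-- Conversely, an automorphism π fixing u permutes the neighbours v, x_{1,1}, …, x_{1,k} of u.
-- It must fix v: were π v = x_{1,c}, the k ≥ 2 neighbours x_{ℓ-1,a} of v would be mapped
-- injectively into the neighbours of x_{1,c} other than u, of which x_{2,c} is the only one.
-- Hence π sends x_{1,a} to some x_{1,b}, and walking outward, since x_{j+1,a} is the
-- neighbour of x_{j,a} other than x_{j-1,a}, π maps the whole path a onto path b.
module Submission where

open import Defs
open import Data.Nat using (ℕ; zero; suc; _≤_; _<_; _<?_; z≤n; s≤s)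
open import Data.Nat.Properties
  using (≤-refl; <-irrefl; ≤-antisym; ≮⇒≥; <⇒≤; <⇒≢; m≤n⇒m≤1+n; m<n⇒m≤1+n; n<1+n; m<n⇒m<1+n)
open import Data.Fin using (Fin; fromℕ<; toℕ) renaming (zero to fzero; suc to fsuc)
open import Data.Fin.Properties using (toℕ-fromℕ<; fromℕ<-toℕ; toℕ<n; _≟_)
open import Data.Fin.Permutation
  using (Permutation; _⟨$⟩ʳ_; _⟨$⟩ˡ_; inverseˡ; inverseʳ; transpose) renaming (id to idₚ)
open import Data.Product using (∃-syntax; _,_; proj₁; proj₂)
open import Data.Sum using (_⊎_; inj₁; inj₂)
open import Data.Empty using (⊥-elim)
open import Function.Base using (case_of_)
open import Function.Bundles using (_⇔_; mk⇔; Equivalence)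
open import Function.Definitions using (Bijective)
open import Function.Consequences.Propositional
  using (inverseᵇ⇒bijective; strictlyInverseˡ⇒inverseˡ; strictlyInverseʳ⇒inverseʳ)
open import Relation.Nullary using (¬_; yes; no)
open import Relation.Nullary.Decidable using (dec-true)
open import Relation.Binary.PropositionalEquality

module _ {m k : ℕ} where

  level : Vtx m k → ℕ
  level U = 0
  level V = suc m
  level (X j a) = suc (toℕ j)

  vert-inner : ∀ {i} {a : Fin k} (i<m : i < m) → vert m (suc i) a ≡ X (fromℕ< i<m) a
  vert-inner {i} i<m with i <? m
  ... | yes _ = refl
  ... | no i≮m = ⊥-elim (i≮m i<m)

  vert-outer : ∀ {i} {a : Fin k} → ¬ (i < m) → vert m (suc i) a ≡ V
  vert-outer {i} i≮m with i <? m
  ... | yes i<m = ⊥-elim (i≮m i<m)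
  ... | no _ = refl

  vert-end : ∀ {a : Fin k} → vert m (suc m) a ≡ V
  vert-end = vert-outer (<-irrefl refl)

  vert-toℕ : ∀ {j : Fin m} {a : Fin k} → vert m (suc (toℕ j)) a ≡ X j a
  vert-toℕ {j} = trans (vert-inner (toℕ<n j)) (cong (λ i → X i _) (fromℕ<-toℕ j _))

  vert-suc≢U : ∀ {i} {a : Fin k} → ¬ (vert m (suc i) a ≡ U)
  vert-suc≢U {i} with i <? m
  ... | yes _ = λ ()
  ... | no _ = λ ()

  level-vert : ∀ {i} {a : Fin k} → i ≤ suc m → level (vert m i a) ≡ i
  level-vert {zero} _ = refl
  level-vert {suc i} (s≤s i≤m) with i <? m
  ... | yes i<m = cong suc (toℕ-fromℕ< i<m)
  ... | no i≮m = cong suc (≤-antisym (≮⇒≥ i≮m) i≤m)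

  vert-injectiveˡ : ∀ {i j} {a b : Fin k} → i ≤ suc m → j ≤ suc m →
    vert m i a ≡ vert m j b → i ≡ j
  vert-injectiveˡ i≤ j≤ e = trans (sym (level-vert i≤)) (trans (cong level e) (level-vert j≤))

  vert-injectiveʳ : ∀ {i} {a b : Fin k} → 0 < i → i ≤ m → vert m i a ≡ vert m i b → a ≡ b
  vert-injectiveʳ {suc i} _ i<m e with trans (sym (vert-inner i<m)) (trans e (vert-inner i<m))
  ... | refl = refl

  Adj-U : ∀ {y z} → Adj m k y z → y ≡ U → z ≡ V ⊎ ∃[ b ] z ≡ vert m 1 b
  Adj-U edge-uv _ = inj₁ refl
  Adj-U edge-vu ()
  Adj-U (path-fw a zero _) _ = inj₂ (a , refl)
  Adj-U (path-fw a (suc j) _) y≡U = ⊥-elim (vert-suc≢U y≡U)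
  Adj-U (path-bw a j _) y≡U = ⊥-elim (vert-suc≢U y≡U)

  Adj-inner : ∀ {i y z} {b : Fin k} → i < m → Adj m k y z → y ≡ vert m (suc i) b →
    z ≡ vert m i b ⊎ z ≡ vert m (suc (suc i)) b
  Adj-inner _ edge-uv e = ⊥-elim (vert-suc≢U (sym e))
  Adj-inner i<m edge-vu e with trans e (vert-inner i<m)
  ... | ()
  Adj-inner i<m (path-fw a j j≤m) e
    with refl ← vert-injectiveˡ (m≤n⇒m≤1+n j≤m) (s≤s (<⇒≤ i<m)) e
    with refl ← vert-injectiveʳ (s≤s z≤n) i<m e = inj₂ refl
  Adj-inner i<m (path-bw a j j≤m) e
    with refl ← vert-injectiveˡ (s≤s j≤m) (s≤s (<⇒≤ i<m)) e
    with refl ← vert-injectiveʳ (s≤s z≤n) i<m e = inj₁ refl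

  permutePaths : (Fin k → Fin k) → Vtx m k → Vtx m k
  permutePaths σ U = U
  permutePaths σ V = V
  permutePaths σ (X j a) = X j (σ a)

  permutePaths-vert : ∀ σ i (a : Fin k) → permutePaths σ (vert m i a) ≡ vert m i (σ a)
  permutePaths-vert σ zero a = refl
  permutePaths-vert σ (suc i) a with i <? m
  ... | yes _ = refl
  ... | no _ = refl

  permutePaths-Adj : ∀ σ {y z} → Adj m k y z → Adj m k (permutePaths σ y) (permutePaths σ z)
  permutePaths-Adj σ edge-uv = edge-uv
  permutePaths-Adj σ edge-vu = edge-vu
  permutePaths-Adj σ (path-fw a j j≤m) =
    subst₂ (Adj m k) (sym (permutePaths-vert σ j a)) (sym (permutePaths-vert σ (suc j) a))
      (path-fw (σ a) j j≤m)
  permutePaths-Adj σ (path-bw a j j≤m) =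
    subst₂ (Adj m k) (sym (permutePaths-vert σ (suc j) a)) (sym (permutePaths-vert σ j a))
      (path-bw (σ a) j j≤m)

  permutePaths-inverse : ∀ {σ τ} → (∀ a → τ (σ a) ≡ a) → ∀ y → permutePaths τ (permutePaths σ y) ≡ y
  permutePaths-inverse inv U = refl
  permutePaths-inverse inv V = refl
  permutePaths-inverse inv (X j a) = cong (X j) (inv a)

  permutePaths-isAutomorphism : (σ : Permutation k k) → IsAutomorphism m k (permutePaths (σ ⟨$⟩ʳ_))
  permutePaths-isAutomorphism σ = bijective , λ y z → mk⇔ (permutePaths-Adj σʳ) (reflect y z)
    where
      σʳ σˡ : Fin k → Fin k
      σʳ = σ ⟨$⟩ʳ_
      σˡ = σ ⟨$⟩ˡ_
      left : ∀ y → permutePaths σˡ (permutePaths σʳ y) ≡ y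
      left = permutePaths-inverse (λ _ → inverseˡ σ)
      bijective : Bijective _≡_ _≡_ (permutePaths σʳ)
      bijective = inverseᵇ⇒bijective
        ( strictlyInverseˡ⇒inverseˡ (permutePaths σʳ) (permutePaths-inverse (λ _ → inverseʳ σ))
        , strictlyInverseʳ⇒inverseʳ (permutePaths σʳ) left)
      reflect : ∀ y z → Adj m k (permutePaths σʳ y) (permutePaths σʳ z) → Adj m k y z
      reflect y z adj = subst₂ (Adj m k) (left y) (left z) (permutePaths-Adj σˡ adj)

  permutePaths-∼u : (σ : Permutation k k) (y : Vtx m k) → y ∼u permutePaths (σ ⟨$⟩ʳ_) y
  permutePaths-∼u σ y = permutePaths (σ ⟨$⟩ʳ_) , permutePaths-isAutomorphism σ , refl , refl

module FixingU {m k} {π : Vtx m k → Vtx m k} (π-aut : IsAutomorphism m k π) (πU≡U : π U ≡ U) where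

  π-injective : ∀ {y z} → π y ≡ π z → y ≡ z
  π-injective = proj₁ (proj₁ π-aut)

  π-Adj : ∀ {y z} → Adj m k y z → Adj m k (π y) (π z)
  π-Adj {y} {z} = Equivalence.to (proj₂ π-aut y z)

  V↦x₁-impossible : ∀ {a b c : Fin k} → ¬ (a ≡ b) → 0 < m → ¬ (π V ≡ vert m 1 c)
  V↦x₁-impossible {a} {b} {c} a≢b 0<m πV≡x₁ =
    a≢b (vert-injectiveʳ 0<m ≤-refl (π-injective (trans (last↦second a) (sym (last↦second b)))))
    where
      last↦second : ∀ d → π (vert m m d) ≡ vert m 2 c
      last↦second d with Adj-inner 0<m (π-Adj (subst (λ y → Adj m k y (vert m m d)) vert-end
                                                      (path-bw d m ≤-refl))) πV≡x₁
      ... | inj₂ e = e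
      ... | inj₁ e = ⊥-elim (<⇒≢ 0<m (sym (vert-injectiveˡ {b = d} (m≤n⇒m≤1+n ≤-refl) z≤n
                                              (π-injective (trans e (sym πU≡U))))))

  fixes-V : (a b : Fin k) → ¬ (a ≡ b) → π V ≡ V
  fixes-V a b a≢b with Adj-U (π-Adj edge-uv) πU≡U
  ... | inj₁ πV≡V = πV≡V
  -- `case` rather than `with`: abstracting over `0 <? m` would also rewrite the type of πV≡x₁.
  ... | inj₂ (c , πV≡x₁) = case 0 <? m of λ where
    (yes 0<m) → ⊥-elim (V↦x₁-impossible a≢b 0<m πV≡x₁)
    (no 0≮m) → trans πV≡x₁ (vert-outer 0≮m)

  module _ (πV≡V : π V ≡ V) where

    maps-first : ∀ a → ∃[ b ] π (vert m 1 a) ≡ vert m 1 b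
    maps-first a with Adj-U (π-Adj (path-fw a 0 z≤n)) πU≡U
    ... | inj₂ step = step
    ... | inj₁ e = a , trans e (sym (π-injective (trans e (sym πV≡V))))

    maps-next : ∀ {n} {a b : Fin k} → n < m →
      π (vert m n a) ≡ vert m n b → π (vert m (suc n) a) ≡ vert m (suc n) b →
      π (vert m (suc (suc n)) a) ≡ vert m (suc (suc n)) b
    maps-next {n} {a} n<m prev cur with Adj-inner n<m (π-Adj (path-fw a (suc n) n<m)) cur
    ... | inj₂ e = e
    ... | inj₁ e = ⊥-elim (<⇒≢ (m<n⇒m<1+n (n<1+n n)) (sym (vert-injectiveˡ (s≤s n<m)
                      (m<n⇒m≤1+n n<m) (π-injective (trans e (sym prev))))))

    maps-path : ∀ a → ∃[ b ] (∀ i → i ≤ suc m → π (vert m i a) ≡ vert m i b)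
    maps-path a with maps-first a
    ... | b , first = b , along
      where
        along : ∀ i → i ≤ suc m → π (vert m i a) ≡ vert m i b
        along zero _ = πU≡U
        along (suc zero) _ = first
        along (suc (suc n)) (s≤s n<m) =
          maps-next n<m (along n (m<n⇒m≤1+n n<m)) (along (suc n) (m≤n⇒m≤1+n n<m))

    preserves-block : ∀ y → ¬ (y ≡ U) → SameBlock y (π y)
    preserves-block U y≢U = ⊥-elim (y≢U refl)
    preserves-block V _ = subst (SameBlock V) (sym πV≡V) both-v
    preserves-block (X j a) _ with maps-path a
    ... | b , along = subst (SameBlock (X j a)) (sym πX) (same-level j a b)
      where
        open ≡-Reasoning
        πX : π (X j a) ≡ X j b
        πX = begin
          π (X j a)                  ≡⟨ cong π (sym vert-toℕ) ⟩
          π (vert m (suc (toℕ j)) a) ≡⟨ along (suc (toℕ j)) (s≤s (<⇒≤ (toℕ<n j))) ⟩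
          vert m (suc (toℕ j)) b     ≡⟨ vert-toℕ ⟩
          X j b                      ∎

transpose-maps : ∀ {n} (a b : Fin n) → transpose a b ⟨$⟩ʳ a ≡ b
transpose-maps a b rewrite dec-true (a ≟ a) refl = refl

proposition16 : (m k : ℕ) → 2 ≤ k → (y z : Vtx m k) → ¬ (y ≡ U) → ¬ (z ≡ U) →
    ((y ∼u z) ⇔ SameBlock y z)
proposition16 m (suc (suc k)) (s≤s (s≤s _)) y z y≢U _ = mk⇔ sameBlock similar
  where
    sameBlock : y ∼u z → SameBlock y z
    sameBlock (π , π-aut , πU≡U , refl) =
      preserves-block (fixes-V fzero (fsuc fzero) λ ()) y y≢U
      where open FixingU π-aut πU≡U
    similar : SameBlock y z → y ∼u z
    similar both-v = permutePaths-∼u idₚ V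
    similar (same-level j a b) =
      subst (X j a ∼u_) (cong (X j) (transpose-maps a b)) (permutePaths-∼u (transpose a b) (X j a))
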